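{- Let $x$ be a state of the Gamma ensemble $\mathfrak{S}^\Gamma_\lambda$. For $1\le k\le n$, let $d_k$ be the sum of the column labels of the vertical edges carrying spin $-$ directly above the vertices of row $k$, and let $d_{n+1}=0$. Then the Boltzmann weight of $x$ equals $\prod_{k=1}^n z_k^{\mu_k}$ times a polynomial in $t_1,\dots,t_n$, where $\mu_k=d_k-d_{k+1}$ for $k=1,\dots,n$.
   Context: Fix $n\ge1$, a partition $\lambda=(\lambda_1\ge\cdots\ge\lambda_n\ge0)$ of integers, nonzero complex numbers (or indeterminates) $z_1,\dots,z_n$ and complex numbers (or indeterminates) $t_1,\dots,t_n$. Consider a rectangular grid of vertices with $n$ rows, numbered $1,\dots,n$ from top to bottom, and $\lambda_1+n$ columns, labeled $\lambda_1+n-1,\dots,1,0$ from left to right. Each vertex has four adjacent edges (left, top, right, bottom); edges between adjacent vertices are shared, and there are boundary edges on the left of each row, the right of each row, the top of each column and the bottom of each column. A state is an assignment of a spin $\pm$ to each edge such that: all left boundary edges and all bottom boundary edges carry $+$; all right boundary edges carry $-$; the top boundary edge of column $c$ carries $-$ if and only if $c=\lambda_i+n-i$ for some $1\le i\le n$; and at every vertex the spins (left, top, right, bottom) form one of six Gamma ice configurations. The Boltzmann weight of a vertex in row $i$ is: $(+,+,+,+)\mapsto1$; $(-,-,-,-)\mapsto z_i$; $(+,-,+,-)\mapsto t_i$; $(-,+,-,+)\mapsto z_i$; $(-,+,+,-)\mapsto z_i(t_i+1)$; $(+,-,-,+)\mapsto1$ (configurations not in this list are not allowed). The Boltzmann weight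 of a state is the product of the weights of all its vertices. $\mathfrak{S}^\Gamma_\lambda$ denotes the set of all states. -}

module Defs where

open import Level using (0ℓ)
open import Data.Nat using (ℕ; zero; suc; _+_; _∸_)
open import Data.Fin using (Fin; zero; suc; toℕ; fromℕ; inject₁)
import Data.Fin as F
open import Data.Maybe using (Maybe; just; nothing; maybe)
import Data.Maybe as M
open import Data.Product using (Σ; ∃; ∃-syntax; _×_; _,_)
open import Relation.Binary.PropositionalEquality using (_≡_)
open import Algebra.Bundles using (CommutativeRing)

-- Spins and the six Gamma ice configurations (left, top, right, bottom)

data Spin : Set where
  plus minus : Spin

data Gamma : Spin → Spin → Spin → Spin → Set where
  a₁ : Gamma plus  plus  plus  plus
  a₂ : Gamma minus minus minus minus
  b₁ : Gamma plus  minus plus  minus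
  b₂ : Gamma minus plus  minus plus
  c₁ : Gamma minus plus  plus  minus
  c₂ : Gamma plus  minus minus plus

-- Partitions with n parts (λ : Fin n → ℕ, index i ↔ part λ_{i+1})

IsPartition : ∀ {n} → (Fin n → ℕ) → Set
IsPartition {n} lam = ∀ (i j : Fin n) → i F.≤ j → lam j Data.Nat.≤ lam i

-- λ₁ (the largest part); for n = 0 there is no part and we set it to 0
largestPart : ∀ {n} → (Fin n → ℕ) → ℕ
largestPart {zero}  _   = 0
largestPart {suc n} lam = lam zero

cols : ∀ {n} → (Fin n → ℕ) → ℕ
cols {n} lam = largestPart lam + n

-- column label c carries − on its top boundary edge iff c = λ_i + n - i
-- for some 1 ≤ i ≤ n (here i is 0-based, so n - i becomes n ∸ suc i)
TopMinus : ∀ {n} → (Fin n → ℕ) → ℕ → Set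
TopMinus {n} lam c = ∃[ i ] c ≡ lam i + (n ∸ suc (toℕ i))

-- Rows i : Fin n (i = 0 is the top row 1).  Columns are indexed by their
-- label c : Fin m (m = λ₁ + n), label m-1 leftmost, label 0 rightmost.
-- Horizontal edges of row i: h i e, e : Fin (suc m); edge e lies between
-- the columns labelled e (on its left) and e-1 (on its right): the vertex with
-- label c has left edge  h i (suc c)  and right edge  h i (inject₁ c);
-- e = m is the left boundary edge, e = 0 the right boundary edge.
-- Vertical edges of column c: v r c, r : Fin (suc n); the vertex in row i
-- has top edge  v (inject₁ i) c  and bottom edge  v (suc i) c;
-- r = 0 is the top boundary edge, r = n the bottom boundary edge.

record State (n : ℕ) (lam : Fin n → ℕ) : Set where
  field
    h : Fin n → Fin (suc (cols lam)) → Spin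
    v : Fin (suc n) → Fin (cols lam) → Spin
    leftBd   : ∀ i → h i (fromℕ (cols lam)) ≡ plus
    rightBd  : ∀ i → h i zero ≡ minus
    bottomBd : ∀ c → v (fromℕ n) c ≡ plus
    topBd    : ∀ c → (v zero c ≡ minus → TopMinus lam (toℕ c))
                   × (TopMinus lam (toℕ c) → v zero c ≡ minus)
    ice : ∀ i c → Gamma (h i (suc c)) (v (inject₁ i) c) (h i (inject₁ c)) (v (suc i) c)

sumFin : ∀ {m} → (Fin m → ℕ) → ℕ
sumFin {zero}  f = 0
sumFin {suc m} f = f zero + sumFin (λ c → f (suc c))

minusLabel : ∀ {m} → Spin → Fin m → ℕ
minusLabel plus  c = 0
minusLabel minus c = toℕ c

d : ∀ {n lam} → State n lam → Fin n → ℕ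
d x k = sumFin (λ c → minusLabel (State.v x (inject₁ k) c) c)

next : ∀ {n} → Fin n → Maybe (Fin n)
next {suc zero}    zero    = nothing
next {suc (suc n)} zero    = just (suc zero)
next {suc (suc n)} (suc i) = M.map suc (next i)

dNext : ∀ {n lam} → State n lam → Fin n → ℕ
dNext x k = maybe (d x) 0 (next k)

-- Polynomials (with integer coefficients) in variables indexed by Fin n,
-- as syntax, evaluated in a commutative ring

data Poly (n : ℕ) : Set where
  𝟘 𝟙  : Poly n
  var  : Fin n → Poly n
  _⊕_  : Poly n → Poly n → Poly n
  _⊗_  : Poly n → Poly n → Poly n
  ⊝_   : Poly n → Poly n

module _ (R : CommutativeRing 0ℓ 0ℓ) where
  open CommutativeRing R using (Carrier; 0#; 1#; -_) renaming (_+_ to _+R_; _*_ to _*R_)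

  eval : ∀ {n} → Poly n → (Fin n → Carrier) → Carrier
  eval 𝟘 t = 0#
  eval 𝟙 t = 1#
  eval (var i) t = t i
  eval (p ⊕ q) t = eval p t +R eval q t
  eval (p ⊗ q) t = eval p t *R eval q t
  eval (⊝ p) t = - eval p t

  prodFin : ∀ {m} → (Fin m → Carrier) → Carrier
  prodFin {zero}  f = 1#
  prodFin {suc m} f = f zero *R prodFin (λ c → f (suc c))

  pow : Carrier → ℕ → Carrier
  pow x zero    = 1#
  pow x (suc k) = x *R pow x k

  vertexWeight : ∀ {l u r b} → Carrier → Carrier → Gamma l u r b → Carrier
  vertexWeight z t a₁ = 1#
  vertexWeight z t a₂ = z
  vertexWeight z t b₁ = t
  vertexWeight z t b₂ = z
  vertexWeight z t c₁ = z *R (t +R 1#)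
  vertexWeight z t c₂ = 1#

  boltzmann : ∀ {n lam} → State n lam → (z t : Fin n → Carrier) → Carrier
  boltzmann x z t =
    prodFin (λ i → prodFin (λ c → vertexWeight (z i) (t i) (State.ice x i c)))

module Submission where

open import Defs
open import Level using (0ℓ)
open import Data.Nat using (ℕ; zero; suc; _+_; _*_; _≤_; _∸_)
open import Data.Nat.Properties using (+-identityʳ; +-suc; +-assoc; *-zeroʳ; *-identityʳ; m≤m+n; m+n∸m≡n)
open import Data.Nat.Tactic.RingSolver using (solve-∀)
open import Data.Fin using (Fin; toℕ; fromℕ; inject₁) renaming (zero to fzero; suc to fsuc)
open import Data.Maybe using (maybe′)
open import Data.Maybe.Properties using (maybe′-map)
open import Data.Product using (Σ; _×_; _,_)
open import Function using (_∘_)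
open import Algebra.Bundles using (CommutativeRing)
import Algebra.Properties.CommutativeSemigroup as CommSemigroupProperties
import Relation.Binary.Reasoning.Setoid as SetoidReasoning
open import Relation.Binary.PropositionalEquality using (_≡_; refl; sym; trans; cong; cong₂; subst; module ≡-Reasoning)

-- Every Gamma vertex conserves the number of − spins (left + top = right + bottom).
-- Summing this over a row with the column labels as weights telescopes: d_k − d_{k+1}
-- is the number of − spins on the left edges of row k, i.e. the number of vertices of
-- row k whose weight carries a factor z_k.  Each vertex weight is z_k^[left edge is −]
-- times a polynomial in t_k, which gives the factorisation.

minusCount : Spin → ℕ
minusCount plus  = 0
minusCount minus = 1

gamma-conserves : ∀ {l u r b} → Gamma l u r b →
  minusCount l + minusCount u ≡ minusCount r + minusCount b
gamma-conserves a₁ = refl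
gamma-conserves a₂ = refl
gamma-conserves b₁ = refl
gamma-conserves b₂ = refl
gamma-conserves c₁ = refl
gamma-conserves c₂ = refl

sumFin-cong : ∀ {m} {f g : Fin m → ℕ} → (∀ c → f c ≡ g c) → sumFin f ≡ sumFin g
sumFin-cong {zero}  f≡g = refl
sumFin-cong {suc m} f≡g = cong₂ _+_ (f≡g fzero) (sumFin-cong (f≡g ∘ fsuc))

sumFin-zero : ∀ m → sumFin {m} (λ _ → 0) ≡ 0
sumFin-zero zero    = refl
sumFin-zero (suc m) = sumFin-zero m

weightedSum : ∀ {m} → ℕ → (Fin m → ℕ) → ℕ
weightedSum {zero}  k f = 0
weightedSum {suc m} k f = k * f fzero + weightedSum (suc k) (f ∘ fsuc)

sumFin-labels≡weightedSum : ∀ {m} k (f : Fin m → ℕ) →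
  sumFin (λ c → (k + toℕ c) * f c) ≡ weightedSum k f
sumFin-labels≡weightedSum {zero}  k f = refl
sumFin-labels≡weightedSum {suc m} k f = cong₂ _+_
  (cong (_* f fzero) (+-identityʳ k))
  (trans (sumFin-cong (λ c → cong (_* f (fsuc c)) (+-suc k (toℕ c))))
         (sumFin-labels≡weightedSum (suc k) (f ∘ fsuc)))

-- H (fsuc c) and H (inject₁ c) are the values on the left and right edge of vertex c.
weightedSum-conservation : ∀ {m} k (H : Fin (suc m) → ℕ) (T B : Fin m → ℕ) →
  (∀ c → H (fsuc c) + T c ≡ H (inject₁ c) + B c) →
  weightedSum k T + (m + k) * H (fromℕ m) ≡ weightedSum k B + k * H fzero + sumFin (H ∘ fsuc)
weightedSum-conservation {zero}  k H T B conserves = sym (+-identityʳ (k * H fzero))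
weightedSum-conservation {suc m} k H T B conserves = begin
  k * T₀ + WT + suc (m + k) * Hₗ    ≡⟨ cong (λ j → k * T₀ + WT + j * Hₗ) (sym (+-suc m k)) ⟩
  k * T₀ + WT + (m + suc k) * Hₗ    ≡⟨ +-assoc (k * T₀) WT _ ⟩
  k * T₀ + (WT + (m + suc k) * Hₗ)  ≡⟨ cong (k * T₀ +_) rest ⟩
  k * T₀ + (WB + suc k * H₁ + S)    ≡⟨ distribute k T₀ WB H₁ S ⟩
  k * (H₁ + T₀) + WB + H₁ + S       ≡⟨ cong (λ j → k * j + WB + H₁ + S) (conserves fzero) ⟩
  k * (H₀ + B₀) + WB + H₁ + S       ≡⟨ regroup k H₀ B₀ WB H₁ S ⟩
  k * B₀ + WB + k * H₀ + (H₁ + S)   ∎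
  where
  open ≡-Reasoning
  T₀ = T fzero
  B₀ = B fzero
  H₀ = H fzero
  H₁ = H (fsuc fzero)
  Hₗ = H (fromℕ (suc m))
  WT = weightedSum (suc k) (T ∘ fsuc)
  WB = weightedSum (suc k) (B ∘ fsuc)
  S  = sumFin (H ∘ fsuc ∘ fsuc)
  rest = weightedSum-conservation (suc k) (H ∘ fsuc) (T ∘ fsuc) (B ∘ fsuc) (conserves ∘ fsuc)
  distribute : ∀ k a w b s → k * a + (w + suc k * b + s) ≡ k * (b + a) + w + b + s
  distribute = solve-∀
  regroup : ∀ k a b w c s → k * (a + b) + w + c + s ≡ k * b + w + k * a + (c + s)
  regroup = solve-∀

maybe′-next : ∀ {n} {A : Set} (f : Fin (suc n) → A) (k : Fin n) →
  maybe′ (f ∘ inject₁) (f (fromℕ n)) (next k) ≡ f (fsuc k)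
maybe′-next {suc zero}    f fzero    = refl
maybe′-next {suc (suc n)} f fzero    = refl
maybe′-next {suc (suc n)} f (fsuc k) =
  trans (maybe′-map (f ∘ inject₁) (f (fromℕ (suc (suc n)))) fsuc (next k))
        (maybe′-next (f ∘ fsuc) k)

module _ {n : ℕ} {lam : Fin n → ℕ} (x : State n lam) where
  open State x

  -- d_k extended to all horizontal lines of the grid, the last one being the bottom boundary
  lineLabelSum : Fin (suc n) → ℕ
  lineLabelSum r = sumFin (λ c → minusLabel (v r c) c)

  leftMinusCount : Fin n → ℕ
  leftMinusCount i = sumFin (λ c → minusCount (h i (fsuc c)))

  lineLabelSum≡weightedSum : ∀ r → lineLabelSum r ≡ weightedSum 0 (minusCount ∘ v r)
  lineLabelSum≡weightedSum r =
    trans (sumFin-cong (λ c → minusLabel≡ (v r c) c)) (sumFin-labels≡weightedSum 0 (minusCount ∘ v r))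
    where
    minusLabel≡ : ∀ {m} s (c : Fin m) → minusLabel s c ≡ toℕ c * minusCount s
    minusLabel≡ plus  c = sym (*-zeroʳ (toℕ c))
    minusLabel≡ minus c = sym (*-identityʳ (toℕ c))

  lineLabelSum-bottom : lineLabelSum (fromℕ n) ≡ 0
  lineLabelSum-bottom =
    trans (sumFin-cong (λ c → cong (λ s → minusLabel s c) (bottomBd c))) (sumFin-zero (cols lam))

  dNext≡lineLabelSum : ∀ k → dNext x k ≡ lineLabelSum (fsuc k)
  dNext≡lineLabelSum k =
    trans (cong (λ d₀ → maybe′ (d x) d₀ (next k)) (sym lineLabelSum-bottom))
          (maybe′-next lineLabelSum k)

  row-conservation : ∀ k →
    weightedSum 0 (minusCount ∘ v (inject₁ k)) ≡ weightedSum 0 (minusCount ∘ v (fsuc k)) + leftMinusCount k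
  row-conservation k = begin
    W-above
      ≡⟨ sym (+-identityʳ W-above) ⟩
    W-above + 0
      ≡⟨ cong (W-above +_) (sym left-boundary-plus) ⟩
    W-above + (cols lam + 0) * minusCount (h k (fromℕ (cols lam)))
      ≡⟨ weightedSum-conservation 0 (minusCount ∘ h k) _ _ (gamma-conserves ∘ ice k) ⟩
    W-below + 0 + leftMinusCount k
      ≡⟨ cong (_+ leftMinusCount k) (+-identityʳ W-below) ⟩
    W-below + leftMinusCount k
      ∎
    where
    open ≡-Reasoning
    W-above W-below : ℕ
    W-above = weightedSum 0 (minusCount ∘ v (inject₁ k))
    W-below = weightedSum 0 (minusCount ∘ v (fsuc k))
    left-boundary-plus : (cols lam + 0) * minusCount (h k (fromℕ (cols lam))) ≡ 0
    left-boundary-plus rewrite leftBd k = *-zeroʳ (cols lam + 0)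

  d≡dNext+leftMinusCount : ∀ k → d x k ≡ dNext x k + leftMinusCount k
  d≡dNext+leftMinusCount k = begin
    d x k
      ≡⟨ lineLabelSum≡weightedSum (inject₁ k) ⟩
    weightedSum 0 (minusCount ∘ v (inject₁ k))
      ≡⟨ row-conservation k ⟩
    weightedSum 0 (minusCount ∘ v (fsuc k)) + leftMinusCount k
      ≡⟨ cong (_+ leftMinusCount k) (sym (lineLabelSum≡weightedSum (fsuc k))) ⟩
    lineLabelSum (fsuc k) + leftMinusCount k
      ≡⟨ cong (_+ leftMinusCount k) (sym (dNext≡lineLabelSum k)) ⟩
    dNext x k + leftMinusCount k
      ∎
    where open ≡-Reasoning

  dNext≤d : ∀ k → dNext x k ≤ d x k
  dNext≤d k = subst (dNext x k ≤_) (sym (d≡dNext+leftMinusCount k)) (m≤m+n _ _)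

  d∸dNext≡leftMinusCount : ∀ k → d x k ∸ dNext x k ≡ leftMinusCount k
  d∸dNext≡leftMinusCount k =
    trans (cong (_∸ dNext x k) (d≡dNext+leftMinusCount k)) (m+n∸m≡n (dNext x k) (leftMinusCount k))

productPoly : ∀ {m n} → (Fin m → Poly n) → Poly n
productPoly {zero}  p = 𝟙
productPoly {suc m} p = p fzero ⊗ productPoly (p ∘ fsuc)

vertexPoly : ∀ {n l u r b} → Fin n → Gamma l u r b → Poly n
vertexPoly i a₁ = 𝟙
vertexPoly i a₂ = 𝟙
vertexPoly i b₁ = var i
vertexPoly i b₂ = 𝟙
vertexPoly i c₁ = var i ⊕ 𝟙
vertexPoly i c₂ = 𝟙

rowPoly : ∀ {n lam} → State n lam → Fin n → Poly n
rowPoly x i = productPoly (λ c → vertexPoly i (State.ice x i c))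

statePoly : ∀ {n lam} → State n lam → Poly n
statePoly x = productPoly (rowPoly x)

module _ (R : CommutativeRing 0ℓ 0ℓ) where
  open CommutativeRing R
    using (Carrier; _≈_; 1#; *-commutativeSemigroup; setoid)
    renaming (_*_ to _·_; *-cong to ·-cong; *-congʳ to ·-congʳ; *-identityˡ to ·-identityˡ;
              *-identityʳ to ·-identityʳ; *-assoc to ·-assoc;
              refl to ≈-refl; sym to ≈-sym; trans to ≈-trans)
  open CommSemigroupProperties *-commutativeSemigroup using (interchange)

  prodFin-cong : ∀ {m} {f g : Fin m → Carrier} → (∀ c → f c ≈ g c) → prodFin R f ≈ prodFin R g
  prodFin-cong {zero}  f≈g = ≈-refl
  prodFin-cong {suc m} f≈g = ·-cong (f≈g fzero) (prodFin-cong (f≈g ∘ fsuc))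

  prodFin-· : ∀ {m} (f g : Fin m → Carrier) →
    prodFin R (λ c → f c · g c) ≈ prodFin R f · prodFin R g
  prodFin-· {zero}  f g = ≈-sym (·-identityˡ 1#)
  prodFin-· {suc m} f g =
    ≈-trans (·-cong ≈-refl (prodFin-· (f ∘ fsuc) (g ∘ fsuc))) (interchange _ _ _ _)

  pow-+ : ∀ a p q → pow R a (p + q) ≈ pow R a p · pow R a q
  pow-+ a zero    q = ≈-sym (·-identityˡ _)
  pow-+ a (suc p) q = ≈-trans (·-cong ≈-refl (pow-+ a p q)) (≈-sym (·-assoc _ _ _))

  prodFin-pow : ∀ {m} a (e : Fin m → ℕ) → prodFin R (λ c → pow R a (e c)) ≈ pow R a (sumFin e)
  prodFin-pow {zero}  a e = ≈-refl
  prodFin-pow {suc m} a e = ≈-trans (·-cong ≈-refl (prodFin-pow a (e ∘ fsuc))) (≈-sym (pow-+ a (e fzero) _))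

  prodFin-pow-· : ∀ {m} a (e : Fin m → ℕ) (f : Fin m → Carrier) →
    prodFin R (λ c → pow R a (e c) · f c) ≈ pow R a (sumFin e) · prodFin R f
  prodFin-pow-· a e f = ≈-trans (prodFin-· _ f) (·-congʳ (prodFin-pow a e))

  eval-productPoly : ∀ {m n} (p : Fin m → Poly n) t →
    eval R (productPoly p) t ≈ prodFin R (λ c → eval R (p c) t)
  eval-productPoly {zero}  p t = ≈-refl
  eval-productPoly {suc m} p t = ·-cong ≈-refl (eval-productPoly (p ∘ fsuc) t)

  vertexWeight-factor : ∀ {n l u r b} (z t : Fin n → Carrier) i (g : Gamma l u r b) →
    vertexWeight R (z i) (t i) g ≈ pow R (z i) (minusCount l) · eval R (vertexPoly i g) t
  vertexWeight-factor z t i a₁ = ≈-sym (·-identityˡ _)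
  vertexWeight-factor z t i a₂ = ≈-sym (≈-trans (·-identityʳ _) (·-identityʳ _))
  vertexWeight-factor z t i b₁ = ≈-sym (·-identityˡ _)
  vertexWeight-factor z t i b₂ = ≈-sym (≈-trans (·-identityʳ _) (·-identityʳ _))
  vertexWeight-factor z t i c₁ = ≈-sym (·-congʳ (·-identityʳ _))
  vertexWeight-factor z t i c₂ = ≈-sym (·-identityˡ _)

  boltzmann-factor : ∀ {n lam} (x : State n lam) (z t : Fin n → Carrier) →
    boltzmann R x z t ≈ prodFin R (λ i → pow R (z i) (leftMinusCount x i)) · eval R (statePoly x) t
  boltzmann-factor {n} {lam} x z t = begin
    boltzmann R x z t
      ≈⟨ prodFin-cong (λ i → prodFin-cong (λ c → vertexWeight-factor z t i (ice i c))) ⟩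
    prodFin R (λ i → prodFin R (λ c → pow R (z i) (leftMinus i c) · vertexValue i c))
      ≈⟨ prodFin-cong (λ i → prodFin-pow-· (z i) (leftMinus i) (vertexValue i)) ⟩
    prodFin R (λ i → pow R (z i) (leftMinusCount x i) · prodFin R (vertexValue i))
      ≈⟨ prodFin-· (λ i → pow R (z i) (leftMinusCount x i)) (λ i → prodFin R (vertexValue i)) ⟩
    prodFin R (λ i → pow R (z i) (leftMinusCount x i)) · prodFin R (λ i → prodFin R (vertexValue i))
      ≈⟨ ·-cong ≈-refl (≈-sym evalStatePoly) ⟩
    prodFin R (λ i → pow R (z i) (leftMinusCount x i)) · eval R (statePoly x) t ∎
    where
    open State x
    open SetoidReasoning setoid
    leftMinus : Fin n → Fin (cols lam) → ℕ
    leftMinus i c = minusCount (h i (fsuc c))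
    vertexValue : Fin n → Fin (cols lam) → Carrier
    vertexValue i c = eval R (vertexPoly i (ice i c)) t
    evalStatePoly : eval R (statePoly x) t ≈ prodFin R (λ i → prodFin R (vertexValue i))
    evalStatePoly = ≈-trans (eval-productPoly (rowPoly x) t)
      (prodFin-cong (λ i → eval-productPoly (λ c → vertexPoly i (ice i c)) t))

lemma3 : (n : ℕ) → 1 ≤ n → (lam : Fin n → ℕ) → IsPartition lam →
    (x : State n lam) →
    ((k : Fin n) → dNext x k ≤ d x k) ×
    Σ (Poly n) (λ P → (R : CommutativeRing 0ℓ 0ℓ) → (z t : Fin n → CommutativeRing.Carrier R) →
    CommutativeRing._≈_ R (boltzmann R x z t)
    (CommutativeRing._*_ R (prodFin R (λ k → pow R (z k) (d x k ∸ dNext x k))) (eval R P t)))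
lemma3 n _ lam _ x = dNext≤d x , statePoly x , λ R z t →
  let open CommutativeRing R using (*-congʳ; reflexive) renaming (trans to ≈-trans) in
  ≈-trans (boltzmann-factor R x z t)
        (*-congʳ (prodFin-cong R (λ k → reflexive (cong (pow R (z k)) (sym (d∸dNext≡leftMinusCount x k))))))
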